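{- If $\Pi=(\mathcal{P},\mathcal{L})$ is a projective plane of order $n\geq 5$, then $\Pi$ is magic over the group $G=(\mathbb{Z}/n\mathbb{Z})^3$.
   Context: A projective plane $\Pi=(\mathcal{P},\mathcal{L})$ consists of points $\mathcal{P}$ and lines $\mathcal{L}$ (subsets of $\mathcal{P}$) such that any two distinct points lie on a unique common line, any two distinct lines meet in a unique point, and there exist four points no three collinear. A finite projective plane has an order $n$: every line has $n+1$ points, every point is on $n+1$ lines, and $|\mathcal{P}|=|\mathcal{L}|=n^2+n+1$. For an Abelian group $G$, a function $v:\mathcal{P}\to G$ is magic if it is injective and $\sum_{x\in L}v(x)$ is the same for all $L\in\mathcal{L}$ (injectivity implies non-constant). $\Pi$ is magic over $G$ if such a $v$ exists. -}

module Defs where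

open import Data.Nat using (ℕ; zero; suc; _+_; NonZero)
open import Data.Nat.DivMod using (_mod_)
open import Data.Fin using (Fin; toℕ)
open import Data.Fin.Subset using (Subset; _∈_; ∣_∣)
open import Data.Bool using (if_then_else_)
open import Data.Vec using (lookup)
open import Data.Product using (_×_; _,_; Σ; ∃; ∃-syntax)
open import Relation.Binary.PropositionalEquality using (_≡_; _≢_)
open import Relation.Nullary using (¬_)
open import Function.Definitions using (Injective)

-- Projective planes on a finite point set Fin m.
-- Lines are subsets of the point set; 𝓛 is given as a predicate IsLine
-- on subsets.

record ProjectivePlane (m : ℕ) : Set₁ where
  field
    IsLine : Subset m → Set
    two-points : ∀ (p q : Fin m) → p ≢ q →
      ∃[ L ] (IsLine L × p ∈ L × q ∈ L ×
        (∀ L' → IsLine L' → p ∈ L' → q ∈ L' → L' ≡ L))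
    two-lines : ∀ L L' → IsLine L → IsLine L' → L ≢ L' →
      ∃[ p ] (p ∈ L × p ∈ L' ×
        (∀ q → q ∈ L → q ∈ L' → q ≡ p))
    quadrangle : Σ (Fin m) λ a → Σ (Fin m) λ b → Σ (Fin m) λ c → Σ (Fin m) λ d →
      (a ≢ b × a ≢ c × a ≢ d × b ≢ c × b ≢ d × c ≢ d) ×
      (∀ L → IsLine L → ¬ (a ∈ L × b ∈ L × c ∈ L)) ×
      (∀ L → IsLine L → ¬ (a ∈ L × b ∈ L × d ∈ L)) ×
      (∀ L → IsLine L → ¬ (a ∈ L × c ∈ L × d ∈ L)) ×
      (∀ L → IsLine L → ¬ (b ∈ L × c ∈ L × d ∈ L))

HasOrder : ∀ {m} → ProjectivePlane m → ℕ → Set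
HasOrder {m} Π n = ∀ L → ProjectivePlane.IsLine Π L → ∣ L ∣ ≡ suc n

ZMod³ : ℕ → Set
ZMod³ n = Fin n × Fin n × Fin n

module _ (n : ℕ) .{{_ : NonZero n}} where

  _+ₙ_ : Fin n → Fin n → Fin n
  a +ₙ b = (toℕ a + toℕ b) mod n

  0ₙ : Fin n
  0ₙ = 0 mod n

  _⊕_ : ZMod³ n → ZMod³ n → ZMod³ n
  (a₁ , a₂ , a₃) ⊕ (b₁ , b₂ , b₃) = (a₁ +ₙ b₁ , a₂ +ₙ b₂ , a₃ +ₙ b₃)

  𝟘 : ZMod³ n
  𝟘 = (0ₙ , 0ₙ , 0ₙ)

  sumAll : ∀ {m} → (Fin m → ZMod³ n) → ZMod³ n
  sumAll {zero} f = 𝟘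
  sumAll {suc m} f = f Fin.zero ⊕ sumAll (λ i → f (Fin.suc i))

  lineSum : ∀ {m} → (Fin m → ZMod³ n) → Subset m → ZMod³ n
  lineSum v L = sumAll (λ i → if lookup L i then v i else 𝟘)

  IsMagic : ∀ {m} → ProjectivePlane m → (Fin m → ZMod³ n) → Set
  IsMagic Π v = Injective _≡_ _≡_ v ×
    (∀ L L' → ProjectivePlane.IsLine Π L → ProjectivePlane.IsLine Π L' →
      lineSum v L ≡ lineSum v L')

  MagicOverZMod³ : ∀ {m} → ProjectivePlane m → Set
  MagicOverZMod³ {m} Π = ∃[ v ] IsMagic {m} Π v

module Submission where

-- A projective plane of order n ≥ 5 is magic over (ℤ/nℤ)³; the argument below
-- in fact only uses n ≥ 3.
--
-- Two distinct lines meet in exactly one point and a line has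
-- n + 1 ≡ 1 (mod n) points, so |L ∩ K| ≡ 1 (mod n) for ALL lines L, K.  Hence
-- every combination f = Σᵢ wᵢ·1_{Kᵢ} of lines with weights wᵢ ∈ ℕ has all its
-- line sums ≡ Σᵢ wᵢ (mod n): it is "magic mod n".  Reducing three such
-- functions mod n gives a magic labelling by (ℤ/nℤ)³ as soon as the triple of
-- residues is injective.
--
-- The three functions come from a triangle C₀ C₁ C₂.  For a vertex C with
-- opposite side AB the coordinate is f = 1_{AB} + Σ_{y ∈ AB} w(y)·1_{Cy}; at a
-- point x ≠ C it equals [x ∈ AB] + w(p), where p is the projection of x from C
-- onto AB.  With the weights n ∸ 2 at A, n ∸ 1 at B and the distinct ranks
-- 0, …, n ∸ 2 at the other points of AB, the three residues of a point reveal
-- its position relative to the triangle (vertex, side, or interior), and then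
-- the point itself.

open import Defs
open import Data.Nat using (ℕ; zero; suc; _+_; _*_; _∸_; _%_; _≤_; _<_; z≤n; s≤s; NonZero)
open import Data.Nat.Properties
open import Data.Nat.DivMod using (_mod_; %-distribˡ-+; %-distribˡ-*; m<n⇒m%n≡m; n%n≡0; [m+kn]%n≡m%n)
open import Data.Fin using (Fin; toℕ) renaming (zero to fzero; suc to fsuc; _<_ to _<ᶠ_)
import Data.Fin.Properties as Fin
open import Data.Fin.Subset using (Subset; _∈_; _∉_; ∣_∣)
open import Data.Fin.Subset.Properties using (_∈?_)
open import Data.Vec using ([]; _∷_)
open import Data.Vec.Properties using (≡-dec)
open import Data.Bool using (Bool; true; false) renaming (_≟_ to _≟ᵇ_)
open import Data.Product using (_×_; _,_; Σ-syntax; proj₁; proj₂)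
open import Data.Empty using (⊥-elim)
open import Data.Sum using (inj₁; inj₂)
open import Function using (_∘_)
open import Function.Definitions using (Injective)
open import Relation.Binary.PropositionalEquality
open import Relation.Binary.Definitions using (tri<; tri≈; tri>)
open import Relation.Nullary using (¬_; Dec; yes; no; does)
open import Relation.Nullary.Decidable using (dec-true; dec-false; toSum; _×-dec_; ¬?)
open import Algebra.Properties.Semiring.Sum +-*-semiring
  using (sum; sum-cong-≗; sum-replicate-zero; ∑-distrib-+; ∑-comm; *-distribˡ-sum)
open import Algebra.Properties.CommutativeSemigroup *-commutativeSemigroup using (x∙yz≈y∙xz)

open ≡-Reasoning

𝟙 : Bool → ℕ
𝟙 true = 1
𝟙 false = 0

χ : ∀ {p} {P : Set p} → Dec P → ℕ
χ d = 𝟙 (does d)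

χ-yes : ∀ {p} {P : Set p} (d : Dec P) → P → χ d ≡ 1
χ-yes d p rewrite dec-true d p = refl

χ-no : ∀ {p} {P : Set p} (d : Dec P) → ¬ P → χ d ≡ 0
χ-no d ¬p rewrite dec-false d ¬p = refl

χ≤1 : ∀ {p} {P : Set p} (d : Dec P) → χ d ≤ 1
χ≤1 d with does d
... | true = ≤-refl
... | false = z≤n

χ-idem : ∀ {p} {P : Set p} (d : Dec P) → χ d * χ d ≡ χ d
χ-idem d with does d
... | true = refl
... | false = refl

χ-iff : ∀ {p q} {P : Set p} {Q : Set q} (d : Dec P) (e : Dec Q) → (P → Q) → (Q → P) → χ d ≡ χ e
χ-iff (yes p) e P→Q _ = sym (χ-yes e (P→Q p))
χ-iff (no ¬p) e _ Q→P = sym (χ-no e (¬p ∘ Q→P))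

sum-mono : ∀ {k} {f g : Fin k → ℕ} → (∀ i → f i ≤ g i) → sum f ≤ sum g
sum-mono {zero} _ = z≤n
sum-mono {suc k} f≤g = +-mono-≤ (f≤g fzero) (sum-mono (f≤g ∘ fsuc))

sum-single : ∀ {k} (f : Fin k → ℕ) (p : Fin k) → (∀ i → i ≢ p → f i ≡ 0) → sum f ≡ f p
sum-single {suc k} f fzero vanish = begin
  f fzero + sum (f ∘ fsuc)
    ≡⟨ cong (f fzero +_) (trans (sum-cong-≗ (λ i → vanish (fsuc i) λ ())) (sum-replicate-zero k)) ⟩
  f fzero + 0
    ≡⟨ +-identityʳ _ ⟩
  f fzero ∎
sum-single {suc k} f (fsuc p) vanish rewrite vanish fzero (λ ()) =
  sum-single (f ∘ fsuc) p (λ i i≢p → vanish (fsuc i) (i≢p ∘ Fin.suc-injective))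

sum-χ≡ : ∀ {k} (y : Fin k) → sum (λ z → χ (z Fin.≟ y)) ≡ 1
sum-χ≡ y = trans (sum-single _ y (λ z z≢y → χ-no (z Fin.≟ y) z≢y)) (χ-yes (y Fin.≟ y) refl)

ind : ∀ {m} → Subset m → Fin m → ℕ
ind L x = χ (x ∈? L)

ind-∈ : ∀ {m} {L : Subset m} {x} → x ∈ L → ind L x ≡ 1
ind-∈ {L = L} {x = x} = χ-yes (x ∈? L)

ind-∉ : ∀ {m} {L : Subset m} {x} → x ∉ L → ind L x ≡ 0
ind-∉ {L = L} {x = x} = χ-no (x ∈? L)

sum-ind : ∀ {m} (L : Subset m) → sum (ind L) ≡ ∣ L ∣
sum-ind [] = refl
sum-ind (true ∷ L) = cong suc (sum-ind L)
sum-ind (false ∷ L) = sum-ind L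

sumOver : ∀ {m} → Subset m → (Fin m → ℕ) → ℕ
sumOver L f = sum (λ x → ind L x * f x)

sumOver-+ : ∀ {m} (L : Subset m) (f g : Fin m → ℕ) →
  sumOver L (λ x → f x + g x) ≡ sumOver L f + sumOver L g
sumOver-+ L f g =
  trans (sum-cong-≗ (λ x → *-distribˡ-+ (ind L x) (f x) (g x)))
        (∑-distrib-+ (λ x → ind L x * f x) (λ x → ind L x * g x))

module Rank {k : ℕ} {P : Fin k → Set} (P? : ∀ z → Dec (P z)) where

  rank : Fin k → ℕ
  rank y = sum (λ z → χ (z Fin.<? y) * χ (P? z))

  suc-rank : ∀ y → suc (rank y) ≡ sum (λ z → χ (z Fin.<? y) * χ (P? z) + χ (z Fin.≟ y))
  suc-rank y = begin
    suc (rank y)                        ≡⟨ +-comm 1 (rank y) ⟩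
    rank y + 1                          ≡⟨ cong (rank y +_) (sym (sum-χ≡ y)) ⟩
    rank y + sum (λ z → χ (z Fin.≟ y))
      ≡⟨ ∑-distrib-+ (λ z → χ (z Fin.<? y) * χ (P? z)) (λ z → χ (z Fin.≟ y)) ⟨
    sum (λ z → χ (z Fin.<? y) * χ (P? z) + χ (z Fin.≟ y)) ∎

  rank-monotone : ∀ {y y'} → P y → y <ᶠ y' → rank y < rank y'
  rank-monotone {y} {y'} py y<y' = ≤-trans (≤-reflexive (suc-rank y)) (sum-mono termwise)
    where
    termwise : ∀ z → χ (z Fin.<? y) * χ (P? z) + χ (z Fin.≟ y) ≤ χ (z Fin.<? y') * χ (P? z)
    termwise z with z Fin.≟ y
    ... | yes refl rewrite χ-no (z Fin.<? z) (Fin.<-irrefl refl) | χ-yes (P? z) py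
                         | χ-yes (z Fin.<? y') y<y' = ≤-refl
    ... | no _ with z Fin.<? y
    ...   | yes z<y rewrite χ-yes (z Fin.<? y) z<y | χ-yes (z Fin.<? y') (Fin.<-trans z<y y<y') =
      ≤-reflexive (+-identityʳ _)
    ...   | no z≮y rewrite χ-no (z Fin.<? y) z≮y = z≤n

  rank-bound : ∀ {y} → P y → rank y < sum (λ z → χ (P? z))
  rank-bound {y} py = ≤-trans (≤-reflexive (suc-rank y)) (sum-mono termwise)
    where
    termwise : ∀ z → χ (z Fin.<? y) * χ (P? z) + χ (z Fin.≟ y) ≤ χ (P? z)
    termwise z with z Fin.≟ y
    ... | yes refl rewrite χ-no (z Fin.<? z) (Fin.<-irrefl refl) | χ-yes (P? z) py = ≤-refl
    ... | no _ = ≤-trans (≤-reflexive (+-identityʳ _))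
                   (≤-trans (*-monoˡ-≤ (χ (P? z)) (χ≤1 (z Fin.<? y))) (≤-reflexive (*-identityˡ _)))

  rank-injective : ∀ {y y'} → P y → P y' → rank y ≡ rank y' → y ≡ y'
  rank-injective {y} {y'} py py' eq with Fin.<-cmp y y'
  ... | tri< y<y' _ _ = ⊥-elim (<-irrefl eq (rank-monotone py y<y'))
  ... | tri≈ _ y≡y' _ = y≡y'
  ... | tri> _ _ y'<y = ⊥-elim (<-irrefl (sym eq) (rank-monotone py' y'<y))

0<n∸2 : ∀ {n} → 3 ≤ n → 0 < n ∸ 2
0<n∸2 = m<n⇒0<n∸m

n∸2<n∸1 : ∀ {n} → 2 ≤ n → n ∸ 2 < n ∸ 1
n∸2<n∸1 = ∸-monoʳ-< ≤-refl

n∸1<n : ∀ {n} → 1 ≤ n → n ∸ 1 < n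
n∸1<n = ∸-monoʳ-< (s≤s z≤n)

suc[n∸2]≡n∸1 : ∀ {n} → 2 ≤ n → suc (n ∸ 2) ≡ n ∸ 1
suc[n∸2]≡n∸1 2≤n = sym (+-∸-assoc 1 2≤n)

suc[n∸1]≡n : ∀ {n} → 1 ≤ n → suc (n ∸ 1) ≡ n
suc[n∸1]≡n = m+[n∸m]≡n

module Modular (n : ℕ) .{{_ : NonZero n}} where

  infix 4 _≅_
  _≅_ : ℕ → ℕ → Set
  a ≅ b = a % n ≡ b % n

  ≅-+ : ∀ {a a' b b'} → a ≅ a' → b ≅ b' → a + b ≅ a' + b'
  ≅-+ {a} {a'} {b} {b'} e f = begin
    (a + b) % n              ≡⟨ %-distribˡ-+ a b n ⟩
    (a % n + b % n) % n      ≡⟨ cong₂ (λ x y → (x + y) % n) e f ⟩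
    (a' % n + b' % n) % n    ≡⟨ %-distribˡ-+ a' b' n ⟨
    (a' + b') % n            ∎

  ≅-* : ∀ {a a' b b'} → a ≅ a' → b ≅ b' → a * b ≅ a' * b'
  ≅-* {a} {a'} {b} {b'} e f = begin
    (a * b) % n              ≡⟨ %-distribˡ-* a b n ⟩
    (a % n * (b % n)) % n    ≡⟨ cong₂ (λ x y → (x * y) % n) e f ⟩
    (a' % n * (b' % n)) % n  ≡⟨ %-distribˡ-* a' b' n ⟨
    (a' * b') % n            ∎

  ≅-sum : ∀ {k} {f g : Fin k → ℕ} → (∀ i → f i ≅ g i) → sum f ≅ sum g
  ≅-sum {zero} _ = refl
  ≅-sum {suc k} e = ≅-+ (e fzero) (≅-sum (e ∘ fsuc))

  residue : ∀ {a b} → a ≡ b → b < n → a % n ≡ b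
  residue refl = m<n⇒m%n≡m

  toℕ-mod : ∀ a → toℕ (a mod n) ≡ a % n
  toℕ-mod a = Fin.toℕ-fromℕ< _

  mod-≅ : ∀ {a b} → a ≅ b → a mod n ≡ b mod n
  mod-≅ {a} {b} e = Fin.toℕ-injective (trans (toℕ-mod a) (trans e (sym (toℕ-mod b))))

  ≅-mod : ∀ {a b} → a mod n ≡ b mod n → a ≅ b
  ≅-mod {a} {b} e = trans (sym (toℕ-mod a)) (trans (cong toℕ e) (toℕ-mod b))

  mod-+ : ∀ a b → _+ₙ_ n (a mod n) (b mod n) ≡ (a + b) mod n
  mod-+ a b = mod-≅ (begin
    (toℕ (a mod n) + toℕ (b mod n)) % n  ≡⟨ cong₂ (λ x y → (x + y) % n) (toℕ-mod a) (toℕ-mod b) ⟩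
    (a % n + b % n) % n                  ≡⟨ %-distribˡ-+ a b n ⟨
    (a + b) % n                          ∎)

  reduce₃ : ∀ {m} → (Fin m → ℕ) → (Fin m → ℕ) → (Fin m → ℕ) → Fin m → ZMod³ n
  reduce₃ f g h x = (f x mod n , g x mod n , h x mod n)

  lineSum-reduce₃ : ∀ {m} (L : Subset m) (f g h : Fin m → ℕ) →
    lineSum n (reduce₃ f g h) L ≡ (sumOver L f mod n , sumOver L g mod n , sumOver L h mod n)
  lineSum-reduce₃ [] f g h = refl
  lineSum-reduce₃ (true ∷ L) f g h =
    trans (cong (_⊕_ n (reduce₃ f g h fzero)) (lineSum-reduce₃ L (f ∘ fsuc) (g ∘ fsuc) (h ∘ fsuc)))
          (cong₂ _,_ (add-first f) (cong₂ _,_ (add-first g) (add-first h)))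
    where
    add-first : ∀ f → _+ₙ_ n (f fzero mod n) (sumOver L (f ∘ fsuc) mod n)
                      ≡ (1 * f fzero + sumOver L (f ∘ fsuc)) mod n
    add-first f = trans (mod-+ _ _) (cong (λ a → (a + sumOver L (f ∘ fsuc)) mod n) (sym (*-identityˡ _)))
  lineSum-reduce₃ (false ∷ L) f g h =
    trans (cong (_⊕_ n (𝟘 n)) (lineSum-reduce₃ L (f ∘ fsuc) (g ∘ fsuc) (h ∘ fsuc)))
          (cong₂ _,_ (mod-+ 0 _) (cong₂ _,_ (mod-+ 0 _) (mod-+ 0 _)))

module Plane {m : ℕ} (Π : ProjectivePlane m) (n : ℕ) .{{_ : NonZero n}} (order : HasOrder Π n) where
  open ProjectivePlane Π
  open Modular n

  some-line : Σ[ L ∈ Subset m ] IsLine L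
  some-line with quadrangle
  ... | a , b , _ , _ , (a≢b , _) , _ = proj₁ (two-points a b a≢b) , proj₁ (proj₂ (two-points a b a≢b))

  -- The line through two points.  For p ≡ q it is an arbitrary line; this
  -- makes `line` total, which the sums over pencils of lines need.
  line : Fin m → Fin m → Subset m
  line p q with p Fin.≟ q
  ... | yes _ = proj₁ some-line
  ... | no p≢q = proj₁ (two-points p q p≢q)

  line-isLine : ∀ p q → IsLine (line p q)
  line-isLine p q with p Fin.≟ q
  ... | yes _ = proj₂ some-line
  ... | no p≢q = proj₁ (proj₂ (two-points p q p≢q))

  ∈-lineˡ : ∀ {p q} → p ≢ q → p ∈ line p q
  ∈-lineˡ {p} {q} p≢q with p Fin.≟ q
  ... | yes p≡q = ⊥-elim (p≢q p≡q)
  ... | no p≢q = proj₁ (proj₂ (proj₂ (two-points p q p≢q)))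

  ∈-lineʳ : ∀ {p q} → p ≢ q → q ∈ line p q
  ∈-lineʳ {p} {q} p≢q with p Fin.≟ q
  ... | yes p≡q = ⊥-elim (p≢q p≡q)
  ... | no p≢q = proj₁ (proj₂ (proj₂ (proj₂ (two-points p q p≢q))))

  line-unique : ∀ {p q L} → p ≢ q → IsLine L → p ∈ L → q ∈ L → L ≡ line p q
  line-unique {p} {q} {L} p≢q isL p∈L q∈L with p Fin.≟ q
  ... | yes p≡q = ⊥-elim (p≢q p≡q)
  ... | no p≢q = proj₂ (proj₂ (proj₂ (proj₂ (two-points p q p≢q)))) L isL p∈L q∈L

  meet-unique : ∀ {L K x y} → IsLine L → IsLine K → L ≢ K →
    x ∈ L → x ∈ K → y ∈ L → y ∈ K → x ≡ y
  meet-unique isL isK L≢K x∈L x∈K y∈L y∈K with two-lines _ _ isL isK L≢K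
  ... | _ , _ , _ , unique = trans (unique _ x∈L x∈K) (sym (unique _ y∈L y∈K))

  off-line : ∀ {B K C p x} → IsLine B → IsLine K → C ∉ B → C ∈ K → p ∈ K → p ∈ B →
    x ∈ K → x ≢ p → x ∉ B
  off-line isB isK C∉B C∈K p∈K p∈B x∈K x≢p x∈B =
    x≢p (meet-unique isK isB (λ K≡B → C∉B (subst (_ ∈_) K≡B C∈K)) x∈K x∈B p∈K p∈B)

  meet-count : ∀ {L K} → IsLine L → IsLine K → sumOver L (ind K) ≅ 1
  meet-count {L} {K} isL isK with ≡-dec _≟ᵇ_ L K
  ... | yes refl = begin
    sumOver L (ind L) % n  ≡⟨ cong (_% n) (trans (sum-cong-≗ (λ x → χ-idem (x ∈? L))) (sum-ind L)) ⟩
    ∣ L ∣ % n              ≡⟨ cong (_% n) (order L isL) ⟩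
    suc n % n              ≡⟨ cong (λ k → suc k % n) (sym (+-identityʳ n)) ⟩
    (1 + 1 * n) % n        ≡⟨ [m+kn]%n≡m%n 1 1 n ⟩
    1 % n                  ∎
  ... | no L≢K with two-lines L K isL isK L≢K
  ...   | p , p∈L , p∈K , unique =
    cong (_% n) (trans (sum-single _ p elsewhere) (cong₂ _*_ (χ-yes (p ∈? L) p∈L) (χ-yes (p ∈? K) p∈K)))
    where
    elsewhere : ∀ x → x ≢ p → ind L x * ind K x ≡ 0
    elsewhere x x≢p with x ∈? L | x ∈? K
    ... | yes x∈L | yes x∈K = ⊥-elim (x≢p (unique x x∈L x∈K))
    ... | yes _ | no _ = refl
    ... | no _ | _ = refl

  sumOver-lines : ∀ {k} (w : Fin k → ℕ) (K : Fin k → Subset m) → (∀ y → IsLine (K y)) →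
    ∀ {L} → IsLine L → sumOver L (λ x → sum (λ y → w y * ind (K y) x)) ≅ sum w
  sumOver-lines w K isK {L} isL = begin
    sum (λ x → ind L x * sum (λ y → w y * ind (K y) x)) % n
      ≡⟨ cong (_% n) (sum-cong-≗ (λ x → *-distribˡ-sum (ind L x) (λ y → w y * ind (K y) x))) ⟩
    sum (λ x → sum (λ y → ind L x * (w y * ind (K y) x))) % n
      ≡⟨ cong (_% n) (∑-comm (λ x y → ind L x * (w y * ind (K y) x))) ⟩
    sum (λ y → sum (λ x → ind L x * (w y * ind (K y) x))) % n
      ≡⟨ cong (_% n) (sum-cong-≗ λ y →
           trans (sum-cong-≗ (λ x → x∙yz≈y∙xz (ind L x) (w y) (ind (K y) x)))
                 (sym (*-distribˡ-sum (w y) (λ x → ind L x * ind (K y) x)))) ⟩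
    sum (λ y → w y * sumOver L (ind (K y))) % n
      ≡⟨ ≅-sum {f = λ y → w y * sumOver L (ind (K y))} (λ y → ≅-* {w y} refl (meet-count isL (isK y))) ⟩
    sum (λ y → w y * 1) % n
      ≡⟨ cong (_% n) (sum-cong-≗ (λ y → *-identityʳ (w y))) ⟩
    sum w % n ∎

  foot : ∀ {B C x} → IsLine B → C ∉ B → x ≢ C → Σ[ p ∈ Fin m ] p ∈ B × p ∈ line C x
  foot {B} {C} {x} isB C∉B x≢C
    with two-lines (line C x) B (line-isLine C x) isB
                   (λ Cx≡B → C∉B (subst (C ∈_) Cx≡B (∈-lineˡ (≢-sym x≢C))))
  ... | p , p∈Cx , p∈B , _ = p , p∈B , p∈Cx

  line-through : ∀ {C x p} → x ≢ C → p ≢ C → p ∈ line C x → line C x ≡ line C p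
  line-through {C} {x} x≢C p≢C p∈Cx = line-unique (≢-sym p≢C) (line-isLine C x) (∈-lineˡ (≢-sym x≢C)) p∈Cx

  -- A point x ≠ C lies on the line Cy for exactly one y ∈ B, namely the
  -- projection p of x.  So the pencil combination Σ_{y ∈ B} w(y)·1_{Cy} takes
  -- the value w(p) at x.
  pencil-value : ∀ {B C x p} (w : Fin m → ℕ) → IsLine B → C ∉ B → x ≢ C → p ∈ B → p ∈ line C x →
    sum (λ y → ind B y * w y * ind (line C y) x) ≡ w p
  pencil-value {B} {C} {x} {p} w isB C∉B x≢C p∈B p∈Cx = trans (sum-single _ p elsewhere) at-p
    where
    ≢C : ∀ {y} → y ∈ B → y ≢ C
    ≢C y∈B refl = C∉B y∈B
    Cx≢B : line C x ≢ B
    Cx≢B Cx≡B = C∉B (subst (C ∈_) Cx≡B (∈-lineˡ (≢-sym x≢C)))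
    at-p : ind B p * w p * ind (line C p) x ≡ w p
    at-p = begin
      ind B p * w p * ind (line C p) x
        ≡⟨ cong₂ (λ a b → a * w p * b) (χ-yes (p ∈? B) p∈B)
             (χ-yes (x ∈? line C p)
               (subst (x ∈_) (line-through x≢C (≢C p∈B) p∈Cx) (∈-lineʳ (≢-sym x≢C)))) ⟩
      1 * w p * 1  ≡⟨ *-identityʳ _ ⟩
      1 * w p      ≡⟨ *-identityˡ _ ⟩
      w p          ∎
    elsewhere : ∀ y → y ≢ p → ind B y * w y * ind (line C y) x ≡ 0
    elsewhere y y≢p with y ∈? B | x ∈? line C y
    ... | no _ | _ = refl
    ... | yes _ | no _ = *-zeroʳ (1 * w y)
    ... | yes y∈B | yes x∈Cy = ⊥-elim (y≢p (meet-unique (line-isLine C x) isB Cx≢B y∈Cx y∈B p∈Cx p∈B))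
      where
      y∈Cx : y ∈ line C x
      y∈Cx = subst (y ∈_) (line-through (≢C y∈B) x≢C x∈Cy) (∈-lineʳ (≢-sym (≢C y∈B)))

  Open : Fin m → Fin m → Fin m → Set
  Open P Q x = x ∈ line P Q × x ≢ P × x ≢ Q

  open? : ∀ P Q x → Dec (Open P Q x)
  open? P Q x = (x ∈? line P Q) ×-dec (¬? (x Fin.≟ P) ×-dec ¬? (x Fin.≟ Q))

  weight : Fin m → Fin m → Fin m → ℕ
  weight A B y with y Fin.≟ A | y Fin.≟ B
  ... | yes _ | _ = n ∸ 2
  ... | no _ | yes _ = n ∸ 1
  ... | no _ | no _ = Rank.rank (open? A B) y

  coordinate : Fin m → Fin m → Fin m → Fin m → ℕ
  coordinate C A B x = ind (line A B) x + sum (λ y → ind (line A B) y * weight A B y * ind (line C y) x)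

  MagicMod : (Fin m → ℕ) → Set
  MagicMod f = ∀ {L K} → IsLine L → IsLine K → sumOver L f ≅ sumOver K f

  coordinate-magic : ∀ C A B → MagicMod (coordinate C A B)
  coordinate-magic C A B isL isK = trans (line-sum isL) (sym (line-sum isK))
    where
    pencil : Fin m → ℕ
    pencil y = ind (line A B) y * weight A B y
    line-sum : ∀ {L} → IsLine L → sumOver L (coordinate C A B) ≅ 1 + sum pencil
    line-sum {L} isL = trans (cong (_% n) (sumOver-+ L _ _))
      (≅-+ (meet-count isL (line-isLine A B)) (sumOver-lines pencil (line C) (line-isLine C) isL))

  magic-from-coordinates : ∀ (f g h : Fin m → ℕ) → MagicMod f → MagicMod g → MagicMod h →
    (∀ {x y} → f x ≅ f y → g x ≅ g y → h x ≅ h y → x ≡ y) → MagicOverZMod³ n Π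
  magic-from-coordinates f g h magic-f magic-g magic-h jointly-injective = reduce₃ f g h , injective , magic
    where
    injective : Injective _≡_ _≡_ (reduce₃ f g h)
    injective eq = jointly-injective (≅-mod (cong proj₁ eq)) (≅-mod (cong (proj₁ ∘ proj₂) eq))
                                     (≅-mod (cong (proj₂ ∘ proj₂) eq))
    magic : ∀ L K → IsLine L → IsLine K → lineSum n (reduce₃ f g h) L ≡ lineSum n (reduce₃ f g h) K
    magic L K isL isK = begin
      lineSum n (reduce₃ f g h) L
        ≡⟨ lineSum-reduce₃ L f g h ⟩
      (sumOver L f mod n , sumOver L g mod n , sumOver L h mod n)
        ≡⟨ cong₂ _,_ (mod-≅ (magic-f isL isK))
                     (cong₂ _,_ (mod-≅ (magic-g isL isK)) (mod-≅ (magic-h isL isK))) ⟩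
      (sumOver K f mod n , sumOver K g mod n , sumOver K h mod n)
        ≡⟨ lineSum-reduce₃ K f g h ⟨
      lineSum n (reduce₃ f g h) K ∎

  IsTriangle : Fin m → Fin m → Fin m → Set
  IsTriangle C A B = A ≢ B × C ∉ line A B

  rotate : ∀ {C A B} → IsTriangle C A B → IsTriangle A B C
  rotate {C} {A} {B} (A≢B , C∉AB) = B≢C , A∉BC
    where
    B≢C : B ≢ C
    B≢C refl = C∉AB (∈-lineʳ A≢B)
    A∉BC : A ∉ line B C
    A∉BC A∈BC =
      C∉AB (subst (C ∈_) (line-unique A≢B (line-isLine B C) A∈BC (∈-lineˡ B≢C)) (∈-lineʳ B≢C))

  -- The residues of the coordinate with centre C and base AB, for n ≥ 3:
  --   A ↦ n ∸ 1,  B ↦ 0,  open points of AB ↦ 1 + rank,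
  --   open points of BC ↦ n ∸ 1,  open points of CA ↦ n ∸ 2,
  --   points off the triangle ↦ the rank (< n ∸ 1) of their projection onto AB.
  module Coordinate {C A B : Fin m} (triangle : IsTriangle C A B) (3≤n : 3 ≤ n) where
    open Rank (open? A B)

    f : Fin m → ℕ
    f = coordinate C A B

    A≢B : A ≢ B
    A≢B = proj₁ triangle

    C∉AB : C ∉ line A B
    C∉AB = proj₂ triangle

    B≢C : B ≢ C
    B≢C = proj₁ (rotate triangle)

    C≢A : C ≢ A
    C≢A = proj₁ (rotate (rotate triangle))

    A∈AB : A ∈ line A B
    A∈AB = ∈-lineˡ A≢B

    B∈AB : B ∈ line A B
    B∈AB = ∈-lineʳ A≢B

    n∸1<n′ : n ∸ 1 < n
    n∸1<n′ = n∸1<n (≤-trans (s≤s z≤n) 3≤n)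

    weight-A : weight A B A ≡ n ∸ 2
    weight-A with A Fin.≟ A
    ... | yes _ = refl
    ... | no A≢A = ⊥-elim (A≢A refl)

    weight-B : weight A B B ≡ n ∸ 1
    weight-B with B Fin.≟ A | B Fin.≟ B
    ... | yes B≡A | _ = ⊥-elim (A≢B (sym B≡A))
    ... | no _ | yes _ = refl
    ... | no _ | no B≢B = ⊥-elim (B≢B refl)

    weight-open : ∀ {y} → Open A B y → weight A B y ≡ rank y
    weight-open {y} (_ , y≢A , y≢B) with y Fin.≟ A | y Fin.≟ B
    ... | yes y≡A | _ = ⊥-elim (y≢A y≡A)
    ... | no _ | yes y≡B = ⊥-elim (y≢B y≡B)
    ... | no _ | no _ = refl

    value-by-projection : ∀ {x p} → x ≢ C → p ∈ line A B → p ∈ line C x →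
      f x ≡ ind (line A B) x + weight A B p
    value-by-projection {x} x≢C p∈AB p∈Cx =
      cong (ind (line A B) x +_) (pencil-value (weight A B) (line-isLine A B) C∉AB x≢C p∈AB p∈Cx)

    ind-AB : ∀ z → ind (line A B) z ≡ χ (open? A B z) + (χ (z Fin.≟ A) + χ (z Fin.≟ B))
    ind-AB z with toSum (z Fin.≟ A) | toSum (z Fin.≟ B)
    ... | inj₁ refl | inj₁ z≡B = ⊥-elim (A≢B z≡B)
    ... | inj₁ refl | inj₂ z≢B = trans (ind-∈ A∈AB) (sym (cong₂ _+_
      (χ-no (open? A B z) (λ o → proj₁ (proj₂ o) refl))
      (cong₂ _+_ (χ-yes (z Fin.≟ z) refl) (χ-no (z Fin.≟ B) z≢B))))
    ... | inj₂ z≢A | inj₁ refl = trans (ind-∈ B∈AB) (sym (cong₂ _+_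
      (χ-no (open? A B z) (λ o → proj₂ (proj₂ o) refl))
      (cong₂ _+_ (χ-no (z Fin.≟ A) z≢A) (χ-yes (z Fin.≟ z) refl))))
    ... | inj₂ z≢A | inj₂ z≢B = begin
      ind (line A B) z
        ≡⟨ χ-iff (z ∈? line A B) (open? A B z) (λ z∈ → z∈ , z≢A , z≢B) proj₁ ⟩
      χ (open? A B z)
        ≡⟨ +-identityʳ _ ⟨
      χ (open? A B z) + 0
        ≡⟨ cong (χ (open? A B z) +_) (cong₂ _+_ (χ-no (z Fin.≟ A) z≢A) (χ-no (z Fin.≟ B) z≢B)) ⟨
      χ (open? A B z) + (χ (z Fin.≟ A) + χ (z Fin.≟ B)) ∎

    -- The line AB has n + 1 points, so n ∸ 1 of them are open.
    open-count : sum (λ z → χ (open? A B z)) ≡ n ∸ 1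
    open-count = begin
      #open                ≡⟨ m+n∸n≡m _ 2 ⟨
      #open + 2 ∸ 2        ≡⟨ cong (_∸ 2) #open+2 ⟩
      suc n ∸ 2            ∎
      where
      #open : ℕ
      #open = sum (λ z → χ (open? A B z))
      #open+2 : #open + 2 ≡ suc n
      #open+2 = begin
        #open + 2
          ≡⟨ cong (#open +_) (cong₂ _+_ (sum-χ≡ A) (sum-χ≡ B)) ⟨
        #open + (sum (λ z → χ (z Fin.≟ A)) + sum (λ z → χ (z Fin.≟ B)))
          ≡⟨ cong (#open +_) (∑-distrib-+ (λ z → χ (z Fin.≟ A)) (λ z → χ (z Fin.≟ B))) ⟨
        #open + sum (λ z → χ (z Fin.≟ A) + χ (z Fin.≟ B))
          ≡⟨ ∑-distrib-+ (λ z → χ (open? A B z)) (λ z → χ (z Fin.≟ A) + χ (z Fin.≟ B)) ⟨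
        sum (λ z → χ (open? A B z) + (χ (z Fin.≟ A) + χ (z Fin.≟ B)))
          ≡⟨ sum-cong-≗ ind-AB ⟨
        sum (ind (line A B))
          ≡⟨ sum-ind (line A B) ⟩
        ∣ line A B ∣
          ≡⟨ order (line A B) (line-isLine A B) ⟩
        suc n ∎

    rank< : ∀ {y} → Open A B y → rank y < n ∸ 1
    rank< {y} open-y = subst (rank y <_) open-count (rank-bound open-y)

    at-A : f A % n ≡ n ∸ 1
    at-A = residue (begin
      f A                              ≡⟨ value-by-projection (≢-sym C≢A) A∈AB (∈-lineʳ C≢A) ⟩
      ind (line A B) A + weight A B A  ≡⟨ cong₂ _+_ (ind-∈ A∈AB) weight-A ⟩
      suc (n ∸ 2)                      ≡⟨ suc[n∸2]≡n∸1 (≤-trans (n≤1+n 2) 3≤n) ⟩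
      n ∸ 1                            ∎) n∸1<n′

    at-B : f B % n ≡ 0
    at-B = begin
      f B % n                                ≡⟨ cong (_% n) (value-by-projection B≢C B∈AB (∈-lineʳ (≢-sym B≢C))) ⟩
      (ind (line A B) B + weight A B B) % n  ≡⟨ cong (_% n) (cong₂ _+_ (ind-∈ B∈AB) weight-B) ⟩
      suc (n ∸ 1) % n                        ≡⟨ cong (_% n) (suc[n∸1]≡n (≤-trans (s≤s z≤n) 3≤n)) ⟩
      n % n                                  ≡⟨ n%n≡0 n ⟩
      0                                      ∎

    at-open : ∀ {x} → Open A B x → f x % n ≡ suc (rank x)
    at-open {x} open-x@(x∈AB , _) = residue (begin
      f x                                 ≡⟨ value-by-projection x≢C x∈AB (∈-lineʳ (≢-sym x≢C)) ⟩
      ind (line A B) x + weight A B x     ≡⟨ cong₂ _+_ (ind-∈ x∈AB) (weight-open open-x) ⟩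
      suc (rank x)                        ∎) (≤-<-trans (rank< open-x) n∸1<n′)
      where
      x≢C : x ≢ C
      x≢C refl = C∉AB x∈AB

    open-determined : ∀ {x y} → Open A B x → Open A B y → f x ≅ f y → x ≡ y
    open-determined open-x open-y fx≅fy =
      rank-injective open-x open-y (suc-injective (trans (sym (at-open open-x)) (trans fx≅fy (at-open open-y))))

    at-BC : ∀ {x} → Open B C x → f x % n ≡ n ∸ 1
    at-BC {x} (x∈BC , x≢B , x≢C) = residue (begin
      f x                             ≡⟨ value-by-projection x≢C B∈AB B∈Cx ⟩
      ind (line A B) x + weight A B B ≡⟨ cong₂ _+_ (ind-∉ x∉AB) weight-B ⟩
      n ∸ 1                           ∎) n∸1<n′
      where
      B∈Cx : B ∈ line C x
      B∈Cx = subst (B ∈_) (line-unique (≢-sym x≢C) (line-isLine B C) (∈-lineʳ B≢C) x∈BC) (∈-lineˡ B≢C)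
      x∉AB : x ∉ line A B
      x∉AB = off-line (line-isLine A B) (line-isLine B C) C∉AB (∈-lineʳ B≢C) (∈-lineˡ B≢C) B∈AB x∈BC x≢B

    at-CA : ∀ {x} → Open C A x → f x % n ≡ n ∸ 2
    at-CA {x} (x∈CA , x≢C , x≢A) = residue (begin
      f x                             ≡⟨ value-by-projection x≢C A∈AB A∈Cx ⟩
      ind (line A B) x + weight A B A ≡⟨ cong₂ _+_ (ind-∉ x∉AB) weight-A ⟩
      n ∸ 2                           ∎) (<-trans (n∸2<n∸1 (≤-trans (n≤1+n 2) 3≤n)) n∸1<n′)
      where
      A∈Cx : A ∈ line C x
      A∈Cx = subst (A ∈_) (line-unique (≢-sym x≢C) (line-isLine C A) (∈-lineˡ C≢A) x∈CA) (∈-lineʳ C≢A)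
      x∉AB : x ∉ line A B
      x∉AB = off-line (line-isLine A B) (line-isLine C A) C∉AB (∈-lineˡ C≢A) (∈-lineʳ C≢A) A∈AB x∈CA x≢A

    Off : Fin m → Set
    Off x = x ∉ line A B × x ∉ line B C × x ∉ line C A

    off-≢C : ∀ {x} → Off x → x ≢ C
    off-≢C (_ , x∉BC , _) refl = x∉BC (∈-lineʳ B≢C)

    -- A point off the triangle takes the rank of its projection onto AB; the
    -- projection is open since a line through C and A (or B) containing x would
    -- put x on CA (or BC).
    off-value : ∀ {x} → Off x → Σ[ p ∈ Fin m ] Open A B p × p ∈ line C x × f x ≡ rank p
    off-value {x} off@(x∉AB , x∉BC , x∉CA) with foot (line-isLine A B) C∉AB (off-≢C off)
    ... | p , p∈AB , p∈Cx = p , open-p , p∈Cx , fx≡rank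
      where
      x≢C : x ≢ C
      x≢C = off-≢C off
      p≢A : p ≢ A
      p≢A refl = x∉CA (subst (x ∈_) (line-through x≢C (≢-sym C≢A) p∈Cx) (∈-lineʳ (≢-sym x≢C)))
      p≢B : p ≢ B
      p≢B refl =
        x∉BC (subst (x ∈_) (line-unique B≢C (line-isLine C x) p∈Cx (∈-lineˡ (≢-sym x≢C))) (∈-lineʳ (≢-sym x≢C)))
      open-p : Open A B p
      open-p = p∈AB , p≢A , p≢B
      fx≡rank : f x ≡ rank p
      fx≡rank = begin
        f x                              ≡⟨ value-by-projection x≢C p∈AB p∈Cx ⟩
        ind (line A B) x + weight A B p  ≡⟨ cong₂ _+_ (ind-∉ x∉AB) (weight-open open-p) ⟩
        rank p                           ∎

    off-below : ∀ {x} → Off x → f x % n < n ∸ 1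
    off-below off with off-value off
    ... | _ , open-p , _ , fx≡rank =
      subst (_< n ∸ 1) (sym (residue fx≡rank (<-trans (rank< open-p) n∸1<n′))) (rank< open-p)

    off-collinear : ∀ {x y} → Off x → Off y → f x ≅ f y → y ∈ line C x
    off-collinear {x} {y} off-x off-y fx≅fy with off-value off-x | off-value off-y
    ... | p , open-p , p∈Cx , fx≡ | q , open-q , q∈Cy , fy≡ = subst (y ∈_) Cy≡Cx (∈-lineʳ (≢-sym y≢C))
      where
      y≢C : y ≢ C
      y≢C = off-≢C off-y
      x≢C : x ≢ C
      x≢C = off-≢C off-x
      p≡q : p ≡ q
      p≡q = rank-injective open-p open-q (begin
        rank p      ≡⟨ residue fx≡ (<-trans (rank< open-p) n∸1<n′) ⟨
        f x % n     ≡⟨ fx≅fy ⟩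
        f y % n     ≡⟨ residue fy≡ (<-trans (rank< open-q) n∸1<n′) ⟩
        rank q      ∎)
      p≢C : p ≢ C
      p≢C refl = C∉AB (proj₁ open-p)
      Cy≡Cx : line C y ≡ line C x
      Cy≡Cx = trans (line-through y≢C p≢C (subst (_∈ line C y) (sym p≡q) q∈Cy))
                    (sym (line-through x≢C p≢C p∈Cx))

  apart : ∀ {ℓ} {X : Set ℓ} {a b r s} → a ≅ b → a % n ≡ r → b % n ≡ s → r ≢ s → X
  apart a≅b a≡r b≡s r≢s = ⊥-elim (r≢s (trans (sym a≡r) (trans a≅b b≡s)))

  module Triangle {C₀ C₁ C₂ : Fin m} (triangle : IsTriangle C₀ C₁ C₂) (3≤n : 3 ≤ n) where
    module K₀ = Coordinate triangle 3≤n
    module K₁ = Coordinate (rotate triangle) 3≤n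
    module K₂ = Coordinate (rotate (rotate triangle)) 3≤n

    SameCoordinates : Fin m → Fin m → Set
    SameCoordinates x y = K₀.f x ≅ K₀.f y × K₁.f x ≅ K₁.f y × K₂.f x ≅ K₂.f y

    Interior : Fin m → Set
    Interior x = x ∉ line C₁ C₂ × x ∉ line C₂ C₀ × x ∉ line C₀ C₁

    data Position (x : Fin m) : Set where
      vertex₀ : x ≡ C₀ → Position x
      vertex₁ : x ≡ C₁ → Position x
      vertex₂ : x ≡ C₂ → Position x
      side₁₂ : Open C₁ C₂ x → Position x
      side₂₀ : Open C₂ C₀ x → Position x
      side₀₁ : Open C₀ C₁ x → Position x
      interior : Interior x → Position x

    position : ∀ x → Position x
    position x with x Fin.≟ C₀ | x Fin.≟ C₁ | x Fin.≟ C₂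
    ... | yes x≡C₀ | _ | _ = vertex₀ x≡C₀
    ... | no _ | yes x≡C₁ | _ = vertex₁ x≡C₁
    ... | no _ | no _ | yes x≡C₂ = vertex₂ x≡C₂
    ... | no x≢C₀ | no x≢C₁ | no x≢C₂ with x ∈? line C₁ C₂ | x ∈? line C₂ C₀ | x ∈? line C₀ C₁
    ...   | yes x∈ | _ | _ = side₁₂ (x∈ , x≢C₁ , x≢C₂)
    ...   | no _ | yes x∈ | _ = side₂₀ (x∈ , x≢C₂ , x≢C₀)
    ...   | no _ | no _ | yes x∈ = side₀₁ (x∈ , x≢C₀ , x≢C₁)
    ...   | no x∉₁₂ | no x∉₂₀ | no x∉₀₁ = interior (x∉₁₂ , x∉₂₀ , x∉₀₁)

    off₁ : ∀ {x} → Interior x → K₁.Off x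
    off₁ (∉₁₂ , ∉₂₀ , ∉₀₁) = ∉₂₀ , ∉₀₁ , ∉₁₂

    off₂ : ∀ {x} → Interior x → K₂.Off x
    off₂ (∉₁₂ , ∉₂₀ , ∉₀₁) = ∉₀₁ , ∉₁₂ , ∉₂₀

    private
      n∸2<n∸1′ : n ∸ 2 < n ∸ 1
      n∸2<n∸1′ = n∸2<n∸1 (≤-trans (n≤1+n 2) 3≤n)
      0≢n∸2 : 0 ≢ n ∸ 2
      0≢n∸2 = <⇒≢ (0<n∸2 3≤n)
      0≢n∸1 : 0 ≢ n ∸ 1
      0≢n∸1 = <⇒≢ (<-trans (0<n∸2 3≤n) n∸2<n∸1′)
      n∸2≢n∸1 : n ∸ 2 ≢ n ∸ 1
      n∸2≢n∸1 = <⇒≢ n∸2<n∸1′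

    -- The residues of C₀ from C₁ and C₂ are (0, n ∸ 1); no other point has them.
    vertex-determined : ∀ {y} → SameCoordinates C₀ y → y ≡ C₀
    vertex-determined {y} (e₀ , e₁ , e₂) with position y
    ... | vertex₀ y≡C₀ = y≡C₀
    ... | vertex₁ refl = apart e₂ K₂.at-A K₂.at-B (≢-sym 0≢n∸1)
    ... | vertex₂ refl = apart e₁ K₁.at-B K₁.at-A 0≢n∸1
    ... | side₁₂ s = apart e₁ K₁.at-B (K₁.at-CA s) 0≢n∸2
    ... | side₂₀ s = apart e₂ K₂.at-A (K₂.at-CA s) (≢-sym n∸2≢n∸1)
    ... | side₀₁ s = apart e₁ K₁.at-B (K₁.at-BC s) 0≢n∸1
    ... | interior int = apart (sym e₂) refl K₂.at-A (<⇒≢ (K₂.off-below (off₂ int)))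

    -- An open point of C₁C₂ has residues (1 + rank, n ∸ 2, n ∸ 1); the rank
    -- distinguishes it among the open points of C₁C₂, the rest among the others.
    side-determined : ∀ {x y} → Open C₁ C₂ x → SameCoordinates x y → y ≡ x
    side-determined {x} {y} s (e₀ , e₁ , e₂) with position y
    ... | vertex₀ refl = apart e₁ (K₁.at-CA s) K₁.at-B (≢-sym 0≢n∸2)
    ... | vertex₁ refl = apart e₂ (K₂.at-BC s) K₂.at-B (≢-sym 0≢n∸1)
    ... | vertex₂ refl = apart e₁ (K₁.at-CA s) K₁.at-A n∸2≢n∸1
    ... | side₁₂ s′ = sym (K₀.open-determined s s′ e₀)
    ... | side₂₀ s′ = apart e₂ (K₂.at-BC s) (K₂.at-CA s′) (≢-sym n∸2≢n∸1)
    ... | side₀₁ s′ = apart e₁ (K₁.at-CA s) (K₁.at-BC s′) n∸2≢n∸1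
    ... | interior int = apart (sym e₂) refl (K₂.at-BC s) (<⇒≢ (K₂.off-below (off₂ int)))

    -- Two interior points with the same residues from C₀ and C₁ lie on a common
    -- line through C₀ and on one through C₁; these lines differ, so the points
    -- coincide.
    interior-pair : ∀ {x y} → Interior x → Interior y → K₀.f x ≅ K₀.f y → K₁.f x ≅ K₁.f y → y ≡ x
    interior-pair {x} int-x int-y e₀ e₁ =
      sym (meet-unique (line-isLine C₀ x) (line-isLine C₁ x) C₀x≢C₁x
             (∈-lineʳ (≢-sym x≢C₀)) (∈-lineʳ (≢-sym x≢C₁))
             (K₀.off-collinear int-x int-y e₀) (K₁.off-collinear (off₁ int-x) (off₁ int-y) e₁))
      where
      x≢C₀ : x ≢ C₀
      x≢C₀ refl = proj₁ (proj₂ int-x) (∈-lineʳ K₀.B≢C)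
      x≢C₁ : x ≢ C₁
      x≢C₁ refl = proj₂ (proj₂ int-x) (∈-lineʳ K₀.C≢A)
      C₀x≢C₁x : line C₀ x ≢ line C₁ x
      C₀x≢C₁x C₀x≡C₁x = proj₂ (proj₂ int-x) (subst (x ∈_)
        (line-unique K₀.C≢A (line-isLine C₀ x) (∈-lineˡ (≢-sym x≢C₀))
                     (subst (C₁ ∈_) (sym C₀x≡C₁x) (∈-lineˡ (≢-sym x≢C₁))))
        (∈-lineʳ (≢-sym x≢C₀)))

    -- An interior point has all residues below n ∸ 1, while every other point
    -- has some residue n ∸ 1.
    interior-determined : ∀ {x y} → Interior x → SameCoordinates x y → y ≡ x
    interior-determined {x} {y} int (e₀ , e₁ , e₂) with position y
    ... | vertex₀ refl = apart e₂ refl K₂.at-A (<⇒≢ (K₂.off-below (off₂ int)))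
    ... | vertex₁ refl = apart e₀ refl K₀.at-A (<⇒≢ (K₀.off-below int))
    ... | vertex₂ refl = apart e₁ refl K₁.at-A (<⇒≢ (K₁.off-below (off₁ int)))
    ... | side₁₂ s = apart e₂ refl (K₂.at-BC s) (<⇒≢ (K₂.off-below (off₂ int)))
    ... | side₂₀ s = apart e₀ refl (K₀.at-BC s) (<⇒≢ (K₀.off-below int))
    ... | side₀₁ s = apart e₁ refl (K₁.at-BC s) (<⇒≢ (K₁.off-below (off₁ int)))
    ... | interior int′ = interior-pair int int′ e₀ e₁

  -- The three coordinates of a triangle are jointly injective mod n: locate x
  -- relative to the triangle and apply the matching rotation of the triangle.
  module _ {C₀ C₁ C₂ : Fin m} (triangle : IsTriangle C₀ C₁ C₂) (3≤n : 3 ≤ n) where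
    private
      module T₀ = Triangle triangle 3≤n
      module T₁ = Triangle (rotate triangle) 3≤n
      module T₂ = Triangle (rotate (rotate triangle)) 3≤n

    triangle-injective : ∀ {x y} →
      coordinate C₀ C₁ C₂ x ≅ coordinate C₀ C₁ C₂ y →
      coordinate C₁ C₂ C₀ x ≅ coordinate C₁ C₂ C₀ y →
      coordinate C₂ C₀ C₁ x ≅ coordinate C₂ C₀ C₁ y → x ≡ y
    triangle-injective {x} e₀ e₁ e₂ with T₀.position x
    ... | T₀.vertex₀ refl = sym (T₀.vertex-determined (e₀ , e₁ , e₂))
    ... | T₀.vertex₁ refl = sym (T₁.vertex-determined (e₁ , e₂ , e₀))
    ... | T₀.vertex₂ refl = sym (T₂.vertex-determined (e₂ , e₀ , e₁))
    ... | T₀.side₁₂ s = sym (T₀.side-determined s (e₀ , e₁ , e₂))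
    ... | T₀.side₂₀ s = sym (T₁.side-determined s (e₁ , e₂ , e₀))
    ... | T₀.side₀₁ s = sym (T₂.side-determined s (e₂ , e₀ , e₁))
    ... | T₀.interior int = sym (T₀.interior-determined int (e₀ , e₁ , e₂))

  quadrangle-triangle : Σ[ a ∈ Fin m ] Σ[ b ∈ Fin m ] Σ[ c ∈ Fin m ] IsTriangle a b c
  quadrangle-triangle with quadrangle
  ... | a , b , c , _ , (_ , _ , _ , b≢c , _) , not-abc , _ =
    a , b , c , b≢c , λ a∈bc → not-abc (line b c) (line-isLine b c) (a∈bc , ∈-lineˡ b≢c , ∈-lineʳ b≢c)

  magic-from-triangle : ∀ {a b c} → IsTriangle a b c → 3 ≤ n → MagicOverZMod³ n Π
  magic-from-triangle {a} {b} {c} triangle 3≤n =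
    magic-from-coordinates (coordinate a b c) (coordinate b c a) (coordinate c a b)
      (coordinate-magic a b c) (coordinate-magic b c a) (coordinate-magic c a b)
      (triangle-injective triangle 3≤n)

theorem6 : (n : ℕ) .{{_ : NonZero n}} → 5 ≤ n →
    (m : ℕ) (Π : ProjectivePlane m) → HasOrder Π n → MagicOverZMod³ n Π
theorem6 n 5≤n m Π order with Plane.quadrangle-triangle Π n order
... | _ , _ , _ , triangle = Plane.magic-from-triangle Π n order triangle 3≤n
  where
  3≤n : 3 ≤ n
  3≤n = ≤-trans (s≤s (s≤s (s≤s z≤n))) 5≤n
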